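{- Let $\mathcal{H}$ be a finite set of graphs such that there is no $\mathcal{H}$-free $n$-array except possibly for finitely many $n\in\mathbb{N}$. Then $\mathcal{H}$ is tasselled.
   Context: All graphs are finite and simple. $G$ contains $H$ if $H$ is isomorphic to an induced subgraph of $G$; $G$ is $\mathcal{H}$-free if it contains no member of $\mathcal{H}$. An $n$-array is a graph consisting of $n$ pairwise disjoint induced paths $L_1,\dots,L_n$ with no edges between them, and $n$ pairwise non-adjacent vertices $x_1,\dots,x_n$, such that for every $i$, each $x_j$ has a neighbor in $L_i$, and for every $j\le n-1$ all neighbors of $x_j$ in $L_i$ appear along $L_i$ before all neighbors of $x_{j+1}$ in $L_i$. A strand is a path $P$ plus a new vertex $x$ (neck) with at least one neighbor in $P$; a $c$-strand additionally has $x$ non-adjacent to the first $c$ and last $c$ vertices of $P$. A $c$-tassel is obtained from at least $c$ pairwise disjoint copies of a single $c$-strand by identifying their necks into one vertex. $\mathcal{H}$ is tasselled if there is $c\in\mathbb{N}$ such that for every $c$-tassel $T$ there is $H\in\mathcal{H}$ such that $T$ contains each component of $H$. -}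

module Defs where

open import Data.Nat using (ℕ; zero; suc; _+_; _≤_; _<_)
open import Data.Fin using (Fin; toℕ)
open import Data.Bool using (Bool; true; false; _∧_)
open import Data.Maybe using (Maybe; just; nothing)
open import Data.Product using (Σ; Σ-syntax; ∃; ∃-syntax; _×_; _,_; proj₁)
open import Data.Sum using (_⊎_; inj₁; inj₂)
open import Data.List using (List)
open import Data.List.Membership.Propositional using (_∈_)
open import Relation.Binary.PropositionalEquality using (_≡_)
open import Relation.Nullary.Decidable using (⌊_⌋)
open import Data.Fin.Properties using (_≟_)
open import Data.Nat.Properties using () renaming (_≟_ to _≟ℕ_)
open import Function.Definitions using (Injective; Bijective)
open import Function.Bundles using (_⇔_)

record Graph : Set where
  field
    size : ℕ
    adj  : Fin size → Fin size → Bool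
    adj-sym : ∀ i j → adj i j ≡ adj j i
    adj-irr : ∀ i → adj i i ≡ false

open Graph public

ContainsIn : {V : Set} → (V → V → Bool) → Graph → Set
ContainsIn {V} adjG H =
  Σ[ f ∈ (Fin (size H) → V) ]
    (Injective _≡_ _≡_ f × (∀ i j → adj H i j ≡ adjG (f i) (f j)))

Contains : Graph → Graph → Set
Contains G H = ContainsIn (adj G) H

module _ (H : Graph) where

  data Reach (S : Fin (size H) → Bool) : Fin (size H) → Fin (size H) → Set where
    here : ∀ {i} → Reach S i i
    step : ∀ {i k j} → adj H i k ≡ true → S k ≡ true → Reach S k j → Reach S i j

  IsComponent : (Fin (size H) → Bool) → Set
  IsComponent S =
      (∃[ i ] S i ≡ true)
    × (∀ i j → S i ≡ true → S j ≡ true → Reach S i j)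
    × (∀ i j → S i ≡ true → adj H i j ≡ true → S j ≡ true)

  ContainsSubIn : {V : Set} → (V → V → Bool) → (Fin (size H) → Bool) → Set
  ContainsSubIn {V} adjG S =
    Σ[ f ∈ (Σ (Fin (size H)) (λ i → S i ≡ true) → V) ]
      ((∀ p q → f p ≡ f q → proj₁ p ≡ proj₁ q)
     × (∀ p q → adj H (proj₁ p) (proj₁ q) ≡ adjG (f p) (f q)))

  ContainsComponentsIn : {V : Set} → (V → V → Bool) → Set
  ContainsComponentsIn adjG = ∀ S → IsComponent S → ContainsSubIn adjG S

-- vertices x_j (inj₁ j) and the k-th vertex of path L_i (inj₂ (i , k))
ArrV : (n : ℕ) → (Fin n → ℕ) → Set
ArrV n len = Fin n ⊎ Σ (Fin n) (λ i → Fin (len i))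

record IsArray (n : ℕ) (G : Graph) : Set where
  field
    len : Fin n → ℕ
    vtx : ArrV n len → Fin (size G)
    vtx-bij : Bijective _≡_ _≡_ vtx
  x : Fin n → Fin (size G)
  x j = vtx (inj₁ j)
  L : (i : Fin n) → Fin (len i) → Fin (size G)
  L i k = vtx (inj₂ (i , k))
  field
    x-indep : ∀ j j' → adj G (x j) (x j') ≡ false
    L-edges : ∀ i k i' k' →
      (adj G (L i k) (L i' k') ≡ true) ⇔
      (i ≡ i' × (suc (toℕ k) ≡ toℕ k' ⊎ suc (toℕ k') ≡ toℕ k))
    has-nbr : ∀ j i → ∃[ k ] adj G (x j) (L i k) ≡ true
    ordered : ∀ (j j' : Fin n) → toℕ j' ≡ suc (toℕ j) → ∀ i (k k' : Fin (len i)) →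
      adj G (x j) (L i k) ≡ true → adj G (x j') (L i k') ≡ true → toℕ k < toℕ k'

-- c-strands: a path P = p_0 … p_{m-1} and a neck x whose neighbourhood
-- in P is given by nbr.

record Strand (c : ℕ) : Set where
  field
    m   : ℕ
    nbr : Fin m → Bool
    nbr-nonempty : ∃[ k ] nbr k ≡ true
    nbr-away : ∀ (k : Fin m) → (toℕ k < c ⊎ m ≤ toℕ k + c) → nbr k ≡ false

open Strand public

pathAdj : {m : ℕ} → Fin m → Fin m → Bool
pathAdj k k' = ⌊ suc (toℕ k) ≟ℕ toℕ k' ⌋ Data.Bool.∨ ⌊ suc (toℕ k') ≟ℕ toℕ k ⌋
  where import Data.Bool

-- the tassel with t copies of strand s, necks identified into `nothing`
TasselV : ℕ → ℕ → Set
TasselV t m = Maybe (Fin t × Fin m)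

tasselAdj : {c : ℕ} (t : ℕ) (s : Strand c) → TasselV t (m s) → TasselV t (m s) → Bool
tasselAdj t s nothing nothing = false
tasselAdj t s nothing (just (_ , k)) = nbr s k
tasselAdj t s (just (_ , k)) nothing = nbr s k
tasselAdj t s (just (a , k)) (just (b , k')) = ⌊ a ≟ b ⌋ ∧ pathAdj k k'

Tasselled : List Graph → Set
Tasselled ℋ =
  ∃[ c ] ∀ (t : ℕ) → c ≤ t → (s : Strand c) →
    ∃[ H ] (H ∈ ℋ × ContainsComponentsIn H (tasselAdj t s))

-- Take c ≥ N with c ≥ |H| for every H ∈ ℋ, a c-strand s whose path P has m
-- vertices, and t ≥ c. Concatenating t copies ("blocks") of P into each of t
-- paths, and joining x_j to the j-th block of every path as the neck is joined
-- to P, gives a t-array; it contains some H ∈ ℋ, and each component of H embeds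
-- into the tassel made of t copies of s.
--
-- On a connected vertex set of H, a potential that changes by at most 1 along
-- edges takes every intermediate value, so by pigeonhole it varies by less than
-- |H| ≤ c. If a component contains some x_j, the potential "distance to the ends
-- of the block, capped at c" equals c at x_j and therefore never vanishes: the
-- component stays inside block j of the paths, together with x_j, which is a
-- copy of part of the tassel. Otherwise the component lies in one path and its
-- positions span fewer than c values; as a c-strand has m > 2c, a translation
-- moves them into a single copy of P.

module Submission where

open import Defs
open import Data.Bool using (Bool; true; false; _∧_; _∨_)
open import Data.Bool.Properties using (∨-comm; ∧-zeroʳ) renaming (_≟_ to _≟ᵇ_)
open import Data.Empty using (⊥; ⊥-elim)
open import Data.Fin using (Fin; toℕ; fromℕ<; remQuot; combine)
open import Data.Fin.Properties using (_≟_; any?; pigeonhole; toℕ-injective; toℕ<n; toℕ-fromℕ<; toℕ-combine; combine-remQuot; remQuot-combine; +↔⊎; *↔×)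
open import Data.List using (List; map)
open import Data.List.Extrema.Nat using (max; xs≤max)
open import Data.List.Membership.Propositional using (_∈_)
open import Data.List.Relation.Unary.All using (lookup)
open import Data.List.Relation.Unary.All.Properties using (map⁻)
open import Data.Maybe using (just; nothing)
open import Data.Maybe.Properties using (just-injective)
open import Data.Nat using (ℕ; zero; suc; _+_; _*_; _∸_; _⊓_; _≤_; _<_; z≤n; s≤s; s≤s⁻¹; _≤?_; _<?_)
open import Data.Nat.Properties hiding (_≟_)
open import Data.Nat.Properties using () renaming (_≟_ to _≟ℕ_)
open import Data.Product using (Σ; ∃-syntax; _×_; _,_; proj₁; proj₂; map₁; map₂)
open import Data.Product.Properties using (,-injectiveˡ; ,-injectiveʳ)
open import Data.Sum using (_⊎_; inj₁; inj₂)
open import Data.Sum.Function.Propositional using (_⊎-↔_)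
open import Data.Unit using (⊤; tt)
open import Function.Bundles using (_⇔_; mk⇔; _↔_; Inverse; Bijection)
open import Function.Base using (_∘_)
open import Function.Properties.Inverse using (↔-refl; ↔-sym; ↔-trans; ↔⇒⤖)
open import Relation.Binary.Definitions using (tri<; tri≈; tri>)
open import Relation.Binary.PropositionalEquality
open import Relation.Nullary using (¬_; Dec; yes; no)
open import Relation.Nullary.Decidable using (⌊_⌋; _×-dec_; isYes≗does; dec-true; does-⇔)

isYes-⇔ : {P Q : Set} → P ⇔ Q → (p : Dec P) (q : Dec Q) → ⌊ p ⌋ ≡ ⌊ q ⌋
isYes-⇔ P⇔Q p q = trans (isYes≗does p) (trans (does-⇔ P⇔Q p q) (sym (isYes≗does q)))

isYes-complete : {P : Set} (p : Dec P) → P → ⌊ p ⌋ ≡ true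
isYes-complete p x = trans (isYes≗does p) (dec-true p x)

isYes-sound : {P : Set} (p : Dec P) → ⌊ p ⌋ ≡ true → P
isYes-sound (yes x) _ = x
isYes-sound (no _) ()

∧-≡-true : ∀ {a b} → a ∧ b ≡ true → a ≡ true × b ≡ true
∧-≡-true {true} b≡true = refl , b≡true

Neighbours : ℕ → ℕ → Set
Neighbours a b = suc a ≡ b ⊎ suc b ≡ a

pathAdj-neighbours : ∀ {n} {k k' : Fin n} → pathAdj k k' ≡ true → Neighbours (toℕ k) (toℕ k')
pathAdj-neighbours {k = k} {k'} e with suc (toℕ k) ≟ℕ toℕ k' | suc (toℕ k') ≟ℕ toℕ k
... | yes k+1≡k' | _ = inj₁ k+1≡k'
... | no _ | yes k'+1≡k = inj₂ k'+1≡k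
pathAdj-neighbours () | no _ | no _

pathAdj-complete : ∀ {n} (k k' : Fin n) → Neighbours (toℕ k) (toℕ k') → pathAdj k k' ≡ true
pathAdj-complete k k' neighbours with suc (toℕ k) ≟ℕ toℕ k' | suc (toℕ k') ≟ℕ toℕ k | neighbours
... | yes _ | _ | _ = refl
... | no _ | yes _ | _ = refl
... | no k+1≢k' | no _ | inj₁ k+1≡k' = ⊥-elim (k+1≢k' k+1≡k')
... | no _ | no k'+1≢k | inj₂ k'+1≡k = ⊥-elim (k'+1≢k k'+1≡k)

pathAdj-sym : ∀ {n} (k k' : Fin n) → pathAdj k k' ≡ pathAdj k' k
pathAdj-sym k k' = ∨-comm ⌊ suc (toℕ k) ≟ℕ toℕ k' ⌋ ⌊ suc (toℕ k') ≟ℕ toℕ k ⌋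

pathAdj-irrefl : ∀ {n} (k : Fin n) → pathAdj k k ≡ false
pathAdj-irrefl k with suc (toℕ k) ≟ℕ toℕ k
... | yes k+1≡k = ⊥-elim (1+n≢n k+1≡k)
... | no _ = refl

suc-translate : ∀ {x y u v a b} → x + a ≡ u + b → y + a ≡ v + b → suc x ≡ y → suc u ≡ v
suc-translate {u = u} {v} {b = b} e e' refl = +-cancelʳ-≡ b (suc u) v (trans (cong suc (sym e)) e')

pathAdj-translate : ∀ {n n'} {q q' : Fin n} {p p' : Fin n'} a b →
  toℕ q + a ≡ toℕ p + b → toℕ q' + a ≡ toℕ p' + b → pathAdj q q' ≡ pathAdj p p'
pathAdj-translate {q = q} {q'} {p} {p'} _ _ e e' =
  cong₂ _∨_ (isYes-⇔ (mk⇔ (suc-translate e e') (suc-translate (sym e) (sym e')))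
                     (suc (toℕ q) ≟ℕ toℕ q') (suc (toℕ p) ≟ℕ toℕ p'))
            (isYes-⇔ (mk⇔ (suc-translate e' e) (suc-translate (sym e') (sym e)))
                     (suc (toℕ q') ≟ℕ toℕ q) (suc (toℕ p') ≟ℕ toℕ p))

radix-< : ∀ M {j j' r r'} → r < M → j < j' → M * j + r < M * j' + r'
radix-< M {j} {j'} {r} {r'} r<M j<j' = begin-strict
  M * j + r    <⟨ +-monoʳ-< (M * j) r<M ⟩
  M * j + M    ≡⟨ trans (+-comm (M * j) M) (sym (*-suc M j)) ⟩
  M * suc j    ≤⟨ *-monoʳ-≤ M j<j' ⟩
  M * j'       ≤⟨ m≤m+n (M * j') r' ⟩
  M * j' + r'  ∎
  where open ≤-Reasoning

radix-injective : ∀ M {j j' r r'} → r < M → r' < M → M * j + r ≡ M * j' + r' → j ≡ j' × r ≡ r'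
radix-injective M {j} {j'} r<M r'<M e with <-cmp j j'
... | tri< j<j' _ _ = ⊥-elim (<⇒≢ (radix-< M r<M j<j') e)
... | tri≈ _ refl _ = refl , +-cancelˡ-≡ (M * j) _ _ e
... | tri> _ _ j'<j = ⊥-elim (<⇒≢ (radix-< M r'<M j'<j) (sym e))

-- Only the type is new: it makes Agda read suc a' ⊓ suc b' as suc (a' ⊓ b').
⊓-mono-≤-suc : ∀ {a b a' b'} → a ≤ suc a' → b ≤ suc b' → a ⊓ b ≤ suc (a' ⊓ b')
⊓-mono-≤-suc = ⊓-mono-≤

m∸n≤1+m∸[1+n] : ∀ m n → m ∸ n ≤ suc (m ∸ suc n)
m∸n≤1+m∸[1+n] zero n rewrite 0∸n≡0 n = z≤n
m∸n≤1+m∸[1+n] (suc m) zero = s≤s (m∸n≤m m 0)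
m∸n≤1+m∸[1+n] (suc m) (suc n) = m∸n≤1+m∸[1+n] m n

window-bounds : ∀ {x p₀ h c M} → p₀ < x + h → x < p₀ + h → h ≤ c → c + c < M →
  p₀ ≤ x + c × x + c ∸ p₀ < M
window-bounds {x} {p₀} {h} {c} {M} p₀<x+h x<p₀+h h≤c c+c<M =
  p₀≤x+c , subst (x + c ∸ p₀ <_) (m+n∸m≡n p₀ M) (∸-monoˡ-< x+c<p₀+M p₀≤x+c)
  where
  open ≤-Reasoning
  p₀≤x+c : p₀ ≤ x + c
  p₀≤x+c = <⇒≤ (<-≤-trans p₀<x+h (+-monoʳ-≤ x h≤c))
  x+c<p₀+M : x + c < p₀ + M
  x+c<p₀+M = begin-strict
    x + c         <⟨ +-monoˡ-< c x<p₀+h ⟩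
    p₀ + h + c    ≤⟨ +-monoˡ-≤ c (+-monoʳ-≤ p₀ h≤c) ⟩
    p₀ + c + c    ≡⟨ +-assoc p₀ c c ⟩
    p₀ + (c + c)  <⟨ +-monoʳ-< p₀ c+c<M ⟩
    p₀ + M        ∎

module _ (H : Graph) (S : Fin (size H) → Bool) where

  reach-invariant : {X : Set} (κ : Fin (size H) → X) →
    (∀ w w' → S w ≡ true → S w' ≡ true → adj H w w' ≡ true → κ w ≡ κ w') →
    ∀ {a b} → S a ≡ true → Reach H S a b → κ a ≡ κ b
  reach-invariant κ κ-edge sa here = refl
  reach-invariant κ κ-edge sa (step e sk walk) = trans (κ-edge _ _ sa sk e) (reach-invariant κ κ-edge sk walk)

  module _ (φ : Fin (size H) → ℕ)
           (φ-lipschitz : ∀ w w' → S w ≡ true → S w' ≡ true → adj H w w' ≡ true → φ w ≤ suc (φ w')) where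

    reach-intermediate : ∀ {a b} → S a ≡ true → Reach H S a b →
      ∀ r → φ a ≤ r → r ≤ φ b → ∃[ w ] (S w ≡ true × φ w ≡ r)
    reach-intermediate {a} sa here r φa≤r r≤φa = a , sa , ≤-antisym φa≤r r≤φa
    reach-intermediate {a} sa (step {k = k} e sk walk) r φa≤r r≤φb with φ k ≤? r
    ... | yes φk≤r = reach-intermediate sk walk r φk≤r r≤φb
    ... | no φk≰r = a , sa , ≤-antisym φa≤r
      (s≤s⁻¹ (≤-trans (≰⇒> φk≰r) (φ-lipschitz k a sk sa (trans (adj-sym H k a) e))))

    reach-growth : ∀ {a b} → S a ≡ true → Reach H S a b → φ b < φ a + size H
    reach-growth {a} {b} sa walk = ≰⇒> spread-too-large
      where
      level : φ a + size H ≤ φ b → (r : Fin (suc (size H))) → ∃[ w ] (S w ≡ true × φ w ≡ φ a + toℕ r)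
      level φa+|H|≤φb r = reach-intermediate sa walk (φ a + toℕ r) (m≤m+n (φ a) (toℕ r))
        (≤-trans (+-monoʳ-≤ (φ a) (s≤s⁻¹ (toℕ<n r))) φa+|H|≤φb)
      spread-too-large : ¬ φ a + size H ≤ φ b
      spread-too-large φa+|H|≤φb with pigeonhole (n<1+n (size H)) (λ r → proj₁ (level φa+|H|≤φb r))
      ... | i , j , i<j , same-vertex = <⇒≢ i<j (+-cancelˡ-≡ (φ a) _ _
            (trans (sym (proj₂ (proj₂ (level φa+|H|≤φb i))))
                   (trans (cong φ same-vertex) (proj₂ (proj₂ (level φa+|H|≤φb j))))))

containsSub-via : {V W : Set} {adjV : V → V → Bool} {adjW : W → W → Bool} {H : Graph}
  (emb : ContainsIn adjV H) (S : Fin (size H) → Bool) (R : V → Set) →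
  (∀ v → S v ≡ true → R (proj₁ emb v)) → (h : Σ V R → W) →
  (∀ a b → h a ≡ h b → proj₁ a ≡ proj₁ b) →
  (∀ a b → adjV (proj₁ a) (proj₁ b) ≡ adjW (h a) (h b)) →
  ContainsSubIn H adjW S
containsSub-via (g , g-injective , g-adj) S R g-in-R h h-injective h-adj =
    (λ (v , sv) → h (g v , g-in-R v sv))
  , (λ (u , su) (v , sv) e → g-injective (h-injective _ _ e))
  , (λ (u , su) (v , sv) → trans (g-adj u v) (h-adj _ _))

nbr-interior : ∀ {c} (s : Strand c) {k} → nbr s k ≡ true → c ≤ toℕ k × toℕ k + c < m s
nbr-interior {c} s {k} nbr-k with c ≤? toℕ k | toℕ k + c <? m s
... | yes c≤k | yes k+c<m = c≤k , k+c<m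
... | no c≰k | _ with () ← trans (sym nbr-k) (nbr-away s k (inj₁ (≰⇒> c≰k)))
... | yes _ | no k+c≮m with () ← trans (sym nbr-k) (nbr-away s k (inj₂ (≮⇒≥ k+c≮m)))

strand-long : ∀ {c} (s : Strand c) → c + c < m s
strand-long {c} s with nbr-interior s (proj₂ (nbr-nonempty s))
... | c≤k , k+c<m = <-≤-trans (+-monoˡ-< c (s≤s c≤k)) k+c<m

module Array {c : ℕ} (t : ℕ) (s : Strand c) where

  M : ℕ
  M = m s

  Vertex : Set
  Vertex = Fin t ⊎ (Fin t × Fin (t * M))

  block : Fin (t * M) → Fin t
  block p = proj₁ (remQuot {t} M p)

  offset : Fin (t * M) → Fin M
  offset p = proj₂ (remQuot {t} M p)

  toℕ-block-offset : ∀ p → toℕ p ≡ M * toℕ (block p) + toℕ (offset p)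
  toℕ-block-offset p = trans (cong toℕ (sym (combine-remQuot {t} M p))) (toℕ-combine (block p) (offset p))

  block-offset-injective : ∀ {p p'} → block p ≡ block p' → offset p ≡ offset p' → p ≡ p'
  block-offset-injective {p} {p'} b≡b' o≡o' =
    trans (sym (combine-remQuot {t} M p)) (trans (cong₂ combine b≡b' o≡o') (combine-remQuot {t} M p'))

  neckAdj : Fin t → Fin (t * M) → Bool
  neckAdj j p = ⌊ j ≟ block p ⌋ ∧ nbr s (offset p)

  arrayAdj : Vertex → Vertex → Bool
  arrayAdj (inj₁ _) (inj₁ _) = false
  arrayAdj (inj₁ j) (inj₂ (_ , p)) = neckAdj j p
  arrayAdj (inj₂ (_ , p)) (inj₁ j) = neckAdj j p
  arrayAdj (inj₂ (i , p)) (inj₂ (i' , p')) = ⌊ i ≟ i' ⌋ ∧ pathAdj p p'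

  arrayAdj-sym : ∀ a b → arrayAdj a b ≡ arrayAdj b a
  arrayAdj-sym (inj₁ _) (inj₁ _) = refl
  arrayAdj-sym (inj₁ _) (inj₂ _) = refl
  arrayAdj-sym (inj₂ _) (inj₁ _) = refl
  arrayAdj-sym (inj₂ (i , p)) (inj₂ (i' , p')) =
    cong₂ _∧_ (isYes-⇔ (mk⇔ sym sym) (i ≟ i') (i' ≟ i)) (pathAdj-sym p p')

  arrayAdj-irrefl : ∀ a → arrayAdj a a ≡ false
  arrayAdj-irrefl (inj₁ _) = refl
  arrayAdj-irrefl (inj₂ (i , p)) = trans (cong (⌊ i ≟ i ⌋ ∧_) (pathAdj-irrefl p)) (∧-zeroʳ _)

  vertexCode : Vertex ↔ Fin (t + t * (t * M))
  vertexCode = ↔-sym (↔-trans +↔⊎ (↔-refl ⊎-↔ *↔×))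

  open Inverse vertexCode using () renaming (to to encode; from to decode)

  arrayGraph : Graph
  arrayGraph = record
    { size = t + t * (t * M)
    ; adj = λ a b → arrayAdj (decode a) (decode b)
    ; adj-sym = λ a b → arrayAdj-sym (decode a) (decode b)
    ; adj-irr = λ a → arrayAdj-irrefl (decode a)
    }

  adj-encode : ∀ a b → adj arrayGraph (encode a) (encode b) ≡ arrayAdj a b
  adj-encode a b = cong₂ arrayAdj (Inverse.strictlyInverseʳ vertexCode a) (Inverse.strictlyInverseʳ vertexCode b)

  neckAdj-block : ∀ {j p} → neckAdj j p ≡ true → j ≡ block p
  neckAdj-block {j} {p} e = isYes-sound (j ≟ block p) (proj₁ (∧-≡-true e))

  neckAdj-nbr : ∀ {j p} → neckAdj j p ≡ true → nbr s (offset p) ≡ true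
  neckAdj-nbr e = proj₂ (∧-≡-true e)

  neckAdj-in-block : ∀ {j p} → j ≡ block p → neckAdj j p ≡ nbr s (offset p)
  neckAdj-in-block {j} {p} j≡b = cong (_∧ nbr s (offset p)) (isYes-complete (j ≟ block p) j≡b)

  toℕ-in-block : ∀ {j p} → j ≡ block p → toℕ p ≡ M * toℕ j + toℕ (offset p)
  toℕ-in-block {p = p} refl = toℕ-block-offset p

  pathAdj⇔ : ∀ i p i' p' → (arrayAdj (inj₂ (i , p)) (inj₂ (i' , p')) ≡ true) ⇔ (i ≡ i' × Neighbours (toℕ p) (toℕ p'))
  pathAdj⇔ i p i' p' = mk⇔
    (λ e → isYes-sound (i ≟ i') (proj₁ (∧-≡-true e)) , pathAdj-neighbours (proj₂ (∧-≡-true e)))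
    (λ { (refl , neighbours) →
           trans (cong (_∧ pathAdj p p') (isYes-complete (i ≟ i) refl)) (pathAdj-complete p p' neighbours) })

  neck-has-neighbour : ∀ j → ∃[ p ] neckAdj j p ≡ true
  neck-has-neighbour j with nbr-nonempty s
  ... | k , nbr-k = combine j k , trans (neckAdj-in-block (sym (cong proj₁ j,k≡))) (trans (cong (nbr s ∘ proj₂) j,k≡) nbr-k)
    where
    j,k≡ : remQuot {t} M (combine j k) ≡ (j , k)
    j,k≡ = remQuot-combine j k

  neck-neighbours-ordered : ∀ {j j' : Fin t} → toℕ j' ≡ suc (toℕ j) →
    ∀ {p p'} → neckAdj j p ≡ true → neckAdj j' p' ≡ true → toℕ p < toℕ p'
  neck-neighbours-ordered {j} {j'} j'≡j+1 {p} {p'} e e' = begin-strict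
    toℕ p                                 ≡⟨ toℕ-in-block (neckAdj-block e) ⟩
    M * toℕ j + toℕ (offset p)            <⟨ radix-< M (toℕ<n (offset p)) (n<1+n (toℕ j)) ⟩
    M * suc (toℕ j) + toℕ (offset p')     ≡⟨ cong (λ n → M * n + toℕ (offset p')) (sym j'≡j+1) ⟩
    M * toℕ j' + toℕ (offset p')          ≡⟨ sym (toℕ-in-block (neckAdj-block e')) ⟩
    toℕ p'                                ∎
    where open ≤-Reasoning

  arrayGraph-isArray : IsArray t arrayGraph
  arrayGraph-isArray = record
    { len = λ _ → t * M
    ; vtx = encode
    ; vtx-bij = Bijection.bijective (↔⇒⤖ vertexCode)
    ; x-indep = λ j j' → adj-encode (inj₁ j) (inj₁ j')
    ; L-edges = λ i k i' k' →
        subst (λ b → (b ≡ true) ⇔ (i ≡ i' × Neighbours (toℕ k) (toℕ k'))) (sym (adj-encode (inj₂ (i , k)) (inj₂ (i' , k')))) (pathAdj⇔ i k i' k')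
    ; has-nbr = λ j i → map₂ (trans (adj-encode (inj₁ j) (inj₂ (i , _)))) (neck-has-neighbour j)
    ; ordered = λ j j' j'≡j+1 i k k' e e' →
        neck-neighbours-ordered j'≡j+1 (trans (sym (adj-encode (inj₁ j) (inj₂ (i , k)))) e)
                                       (trans (sym (adj-encode (inj₁ j') (inj₂ (i , k')))) e')
    }

  depth : Fin M → ℕ
  depth k = toℕ k ⊓ (M ∸ suc (toℕ k)) ⊓ c

  depth≤c : ∀ k → depth k ≤ c
  depth≤c k = m⊓n≤n _ c

  nbr⇒c≤depth : ∀ {k} → nbr s k ≡ true → c ≤ depth k
  nbr⇒c≤depth {k} nbr-k with nbr-interior s nbr-k
  ... | c≤k , k+c<M = ⊓-glb (⊓-glb c≤k (m+n≤o⇒m≤o∸n c c+k+1≤M)) ≤-refl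
    where
    c+k+1≤M : c + suc (toℕ k) ≤ M
    c+k+1≤M = subst (_≤ M) (trans (cong suc (+-comm (toℕ k) c)) (sym (+-suc c (toℕ k)))) k+c<M

  depth-first : ∀ {k} → toℕ k ≡ 0 → depth k ≡ 0
  depth-first k≡0 rewrite k≡0 = refl

  depth-last : ∀ {k} → suc (toℕ k) ≡ M → depth k ≡ 0
  depth-last {k} k+1≡M rewrite k+1≡M | n∸n≡0 M | ⊓-zeroʳ (toℕ k) = refl

  depth-step : ∀ {k k'} → suc (toℕ k) ≡ toℕ k' → depth k ≤ suc (depth k') × depth k' ≤ suc (depth k)
  depth-step {k} k+1≡k' rewrite sym k+1≡k' =
      ⊓-mono-≤-suc (⊓-mono-≤-suc (≤-trans (n≤1+n _) (n≤1+n _)) (m∸n≤1+m∸[1+n] M (suc (toℕ k)))) (n≤1+n c)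
    , ⊓-mono-≤-suc (⊓-mono-≤-suc ≤-refl (≤-trans (∸-monoʳ-≤ M (n≤1+n _)) (n≤1+n _))) (n≤1+n c)

  digits-suc : ∀ {p p'} → suc (toℕ p) ≡ toℕ p' →
    M * toℕ (block p) + suc (toℕ (offset p)) ≡ M * toℕ (block p') + toℕ (offset p')
  digits-suc {p} {p'} p+1≡p' = begin
    M * toℕ (block p) + suc (toℕ (offset p))  ≡⟨ +-suc _ _ ⟩
    suc (M * toℕ (block p) + toℕ (offset p))  ≡⟨ cong suc (sym (toℕ-block-offset p)) ⟩
    suc (toℕ p)                               ≡⟨ p+1≡p' ⟩
    toℕ p'                                    ≡⟨ toℕ-block-offset p' ⟩
    M * toℕ (block p') + toℕ (offset p')      ∎
    where open ≡-Reasoning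

  positions-consecutive : ∀ {p p'} → suc (toℕ p) ≡ toℕ p' →
      (block p ≡ block p' × suc (toℕ (offset p)) ≡ toℕ (offset p'))
    ⊎ (suc (toℕ (offset p)) ≡ M × toℕ (offset p') ≡ 0)
  positions-consecutive {p} {p'} p+1≡p' with suc (toℕ (offset p)) <? M
  ... | yes o+1<M = inj₁ (map₁ toℕ-injective (radix-injective M o+1<M (toℕ<n (offset p')) (digits-suc p+1≡p')))
  ... | no o+1≮M = inj₂ (o+1≡M , sym (proj₂ (radix-injective M 0<M (toℕ<n (offset p')) (trans carry (digits-suc p+1≡p')))))
    where
    open ≡-Reasoning
    b = toℕ (block p)
    0<M : 0 < M
    0<M = ≤-<-trans z≤n (toℕ<n (offset p))
    o+1≡M : suc (toℕ (offset p)) ≡ M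
    o+1≡M = ≤-antisym (toℕ<n (offset p)) (≮⇒≥ o+1≮M)
    carry : M * suc b + 0 ≡ M * b + suc (toℕ (offset p))
    carry = begin
      M * suc b + 0                 ≡⟨ +-identityʳ _ ⟩
      M * suc b                     ≡⟨ *-suc M b ⟩
      M + M * b                     ≡⟨ +-comm M (M * b) ⟩
      M * b + M                     ≡⟨ cong (M * b +_) (sym o+1≡M) ⟩
      M * b + suc (toℕ (offset p))  ∎

  same-block : ∀ {p p'} → suc (toℕ p) ≡ toℕ p' → 0 < depth (offset p) → block p ≡ block p'
  same-block p+1≡p' 0<depth with positions-consecutive p+1≡p'
  ... | inj₁ (b≡b' , _) = b≡b'
  ... | inj₂ (o+1≡M , _) = ⊥-elim (<⇒≢ 0<depth (sym (depth-last o+1≡M)))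

  depth-consecutive : ∀ {p p'} → suc (toℕ p) ≡ toℕ p' →
    depth (offset p) ≤ suc (depth (offset p')) × depth (offset p') ≤ suc (depth (offset p))
  depth-consecutive p+1≡p' with positions-consecutive p+1≡p'
  ... | inj₁ (_ , o+1≡o') = depth-step o+1≡o'
  ... | inj₂ (o+1≡M , o'≡0) rewrite depth-last o+1≡M | depth-first o'≡0 = z≤n , z≤n

  IsNeck : Vertex → Set
  IsNeck (inj₁ _) = ⊤
  IsNeck (inj₂ _) = ⊥

  isNeck? : ∀ a → Dec (IsNeck a)
  isNeck? (inj₁ _) = yes tt
  isNeck? (inj₂ _) = no λ ()

  height : Vertex → ℕ
  height (inj₁ _) = c
  height (inj₂ (_ , p)) = depth (offset p)

  height-neck : ∀ a → IsNeck a → height a ≡ c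
  height-neck (inj₁ _) _ = refl

  height-lipschitz : ∀ a b → arrayAdj a b ≡ true → height a ≤ suc (height b)
  height-lipschitz (inj₁ _) (inj₂ _) e = ≤-trans (nbr⇒c≤depth (neckAdj-nbr e)) (n≤1+n _)
  height-lipschitz (inj₂ (_ , p)) (inj₁ _) _ = ≤-trans (depth≤c (offset p)) (n≤1+n _)
  height-lipschitz (inj₂ (_ , p)) (inj₂ (_ , p')) e with pathAdj-neighbours (proj₂ (∧-≡-true e))
  ... | inj₁ p+1≡p' = proj₁ (depth-consecutive p+1≡p')
  ... | inj₂ p'+1≡p = proj₂ (depth-consecutive p'+1≡p)

  blockOf : Vertex → Fin t
  blockOf (inj₁ j) = j
  blockOf (inj₂ (_ , p)) = block p

  blockOf-edge : ∀ a b → arrayAdj a b ≡ true → 0 < height a → 0 < height b → blockOf a ≡ blockOf b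
  blockOf-edge (inj₁ _) (inj₂ _) e _ _ = neckAdj-block e
  blockOf-edge (inj₂ _) (inj₁ _) e _ _ = sym (neckAdj-block e)
  blockOf-edge (inj₂ _) (inj₂ _) e 0<ha 0<hb with pathAdj-neighbours (proj₂ (∧-≡-true e))
  ... | inj₁ p+1≡p' = same-block p+1≡p' 0<ha
  ... | inj₂ p'+1≡p = sym (same-block p'+1≡p 0<hb)

  collapse : Vertex → TasselV t M
  collapse (inj₁ _) = nothing
  collapse (inj₂ (i , p)) = just (i , offset p)

  collapse-injective : ∀ a b → blockOf a ≡ blockOf b → collapse a ≡ collapse b → a ≡ b
  collapse-injective (inj₁ _) (inj₁ _) j≡j' _ = cong inj₁ j≡j'
  collapse-injective (inj₂ _) (inj₂ _) b≡b' e =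
    cong inj₂ (cong₂ _,_ (,-injectiveˡ (just-injective e)) (block-offset-injective b≡b' (,-injectiveʳ (just-injective e))))

  offset-translate : ∀ {j p} → j ≡ block p → toℕ p + 0 ≡ toℕ (offset p) + M * toℕ j
  offset-translate {j} {p} j≡b = trans (+-identityʳ (toℕ p)) (trans (toℕ-in-block j≡b) (+-comm (M * toℕ j) (toℕ (offset p))))

  collapse-adj : ∀ a b → blockOf a ≡ blockOf b → arrayAdj a b ≡ tasselAdj t s (collapse a) (collapse b)
  collapse-adj (inj₁ _) (inj₁ _) _ = refl
  collapse-adj (inj₁ _) (inj₂ _) j≡b = neckAdj-in-block j≡b
  collapse-adj (inj₂ _) (inj₁ _) b≡j = neckAdj-in-block (sym b≡j)
  collapse-adj (inj₂ (i , p)) (inj₂ (i' , p')) b≡b' =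
    cong (⌊ i ≟ i' ⌋ ∧_) (pathAdj-translate 0 (M * toℕ (block p)) (offset-translate refl) (offset-translate b≡b'))

  position : Vertex → ℕ
  position (inj₁ _) = 0  -- junk: only used on components without necks
  position (inj₂ (_ , p)) = toℕ p

  position-lipschitz : ∀ a b → ¬ IsNeck a → ¬ IsNeck b → arrayAdj a b ≡ true → position a ≤ suc (position b)
  position-lipschitz (inj₁ _) _ a-path _ _ = ⊥-elim (a-path tt)
  position-lipschitz (inj₂ _) (inj₁ _) _ b-path _ = ⊥-elim (b-path tt)
  position-lipschitz (inj₂ _) (inj₂ _) _ _ e with pathAdj-neighbours (proj₂ (∧-≡-true e))
  ... | inj₁ p+1≡p' = ≤-trans (n≤1+n _) (≤-trans (≤-reflexive p+1≡p') (n≤1+n _))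
  ... | inj₂ p'+1≡p = ≤-reflexive (sym p'+1≡p)

  Window : ℕ → Vertex → Set
  Window p₀ (inj₁ _) = ⊥
  Window p₀ (inj₂ (_ , p)) = p₀ ≤ toℕ p + c × toℕ p + c ∸ p₀ < M

  window-path : ∀ {p₀} a → ¬ IsNeck a → p₀ ≤ position a + c × position a + c ∸ p₀ < M → Window p₀ a
  window-path (inj₁ _) a-path _ = ⊥-elim (a-path tt)
  window-path (inj₂ _) _ in-window = in-window

  slide : ∀ p₀ → Σ Vertex (Window p₀) → TasselV t M
  slide p₀ (inj₂ (i , p) , _ , in-range) = just (i , fromℕ< in-range)

  toℕ-slide : ∀ {p₀ x} (p₀≤x+c : p₀ ≤ x + c) (in-range : x + c ∸ p₀ < M) → x + c ≡ toℕ (fromℕ< in-range) + p₀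
  toℕ-slide p₀≤x+c in-range = sym (trans (cong (_+ _) (toℕ-fromℕ< in-range)) (m∸n+n≡m p₀≤x+c))

  slide-injective : ∀ p₀ a b → slide p₀ a ≡ slide p₀ b → proj₁ a ≡ proj₁ b
  slide-injective p₀ (inj₂ (i , p) , p₀≤ , lt) (inj₂ (i' , p') , p₀≤' , lt') e =
    cong inj₂ (cong₂ _,_ (,-injectiveˡ (just-injective e)) (toℕ-injective (+-cancelʳ-≡ c _ _ p+c≡p'+c)))
    where
    p+c≡p'+c : toℕ p + c ≡ toℕ p' + c
    p+c≡p'+c = trans (toℕ-slide p₀≤ lt)
      (trans (cong (λ k → toℕ k + p₀) (,-injectiveʳ (just-injective e))) (sym (toℕ-slide p₀≤' lt')))

  slide-adj : ∀ p₀ a b → arrayAdj (proj₁ a) (proj₁ b) ≡ tasselAdj t s (slide p₀ a) (slide p₀ b)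
  slide-adj p₀ (inj₂ (i , p) , p₀≤ , lt) (inj₂ (i' , p') , p₀≤' , lt') =
    cong (⌊ i ≟ i' ⌋ ∧_) (pathAdj-translate c p₀ (toℕ-slide p₀≤ lt) (toℕ-slide p₀≤' lt'))

  module _ (H : Graph) (emb : ContainsIn arrayAdj H) (H-small : size H ≤ c) where

    private
      g : Fin (size H) → Vertex
      g = proj₁ emb

      edge : ∀ {u v} → adj H u v ≡ true → arrayAdj (g u) (g v) ≡ true
      edge {u} {v} = trans (sym (proj₂ (proj₂ emb) u v))

    neck-component : ∀ S → IsComponent H S → ∀ u → S u ≡ true → IsNeck (g u) →
      ContainsSubIn H (tasselAdj t s) S
    neck-component S (_ , connected , _) u su u-neck =
      containsSub-via {adjW = tasselAdj t s} {H = H} emb S (λ a → blockOf a ≡ blockOf (g u)) in-block (collapse ∘ proj₁)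
        (λ (a , a∈) (b , b∈) → collapse-injective a b (trans a∈ (sym b∈)))
        (λ (a , a∈) (b , b∈) → collapse-adj a b (trans a∈ (sym b∈)))
      where
      height-positive : ∀ v → S v ≡ true → 0 < height (g v)
      height-positive v sv = ≰⇒> λ height≤0 →
        <⇒≱ (reach-growth H S (height ∘ g) (λ w w' _ _ e → height-lipschitz (g w) (g w') (edge e)) sv (connected v u sv su))
            (begin
              height (g v) + size H  ≤⟨ +-monoˡ-≤ (size H) height≤0 ⟩
              size H                 ≤⟨ H-small ⟩
              c                      ≡⟨ sym (height-neck (g u) u-neck) ⟩
              height (g u)           ∎)
        where open ≤-Reasoning
      in-block : ∀ v → S v ≡ true → blockOf (g v) ≡ blockOf (g u)
      in-block v sv = sym (reach-invariant H S (blockOf ∘ g)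
        (λ w w' sw sw' e → blockOf-edge (g w) (g w') (edge e) (height-positive w sw) (height-positive w' sw'))
        su (connected u v su sv))

    path-component : ∀ S → IsComponent H S → (∀ v → S v ≡ true → ¬ IsNeck (g v)) →
      ContainsSubIn H (tasselAdj t s) S
    path-component S ((u₀ , su₀) , connected , _) no-neck =
      containsSub-via {adjW = tasselAdj t s} {H = H} emb S (Window p₀) in-window (slide p₀) (slide-injective p₀) (slide-adj p₀)
      where
      p₀ : ℕ
      p₀ = position (g u₀)
      growth : ∀ {a b} → S a ≡ true → Reach H S a b → position (g b) < position (g a) + size H
      growth = reach-growth H S (position ∘ g)
        (λ w w' sw sw' e → position-lipschitz (g w) (g w') (no-neck w sw) (no-neck w' sw') (edge e))
      in-window : ∀ v → S v ≡ true → Window p₀ (g v)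
      in-window v sv = window-path (g v) (no-neck v sv)
        (window-bounds (growth sv (connected v u₀ sv su₀)) (growth su₀ (connected u₀ v su₀ sv)) H-small (strand-long s))

    tassel-containsComponents : ContainsComponentsIn H (tasselAdj t s)
    tassel-containsComponents S S-component with any? (λ u → (S u ≟ᵇ true) ×-dec isNeck? (g u))
    ... | yes (u , su , u-neck) = neck-component S S-component u su u-neck
    ... | no no-neck = path-component S S-component (λ v sv v-neck → no-neck (v , sv , v-neck))

  arrayGraph-containsIn : ∀ {H} → Contains arrayGraph H → ContainsIn arrayAdj H
  arrayGraph-containsIn (f , f-injective , f-adj) =
      decode ∘ f
    , (λ {u} {v} e → f-injective (trans (sym (Inverse.strictlyInverseˡ vertexCode (f u)))
                                        (trans (cong encode e) (Inverse.strictlyInverseˡ vertexCode (f v)))))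
    , f-adj

maxSize : List Graph → ℕ
maxSize ℋ = max 0 (map size ℋ)

size≤maxSize : ∀ {H ℋ} → H ∈ ℋ → size H ≤ maxSize ℋ
size≤maxSize {ℋ = ℋ} H∈ℋ = lookup (map⁻ (xs≤max 0 (map size ℋ))) H∈ℋ

theorem1p6 : (ℋ : List Graph) →
    (∃[ N ] ∀ (n : ℕ) → N ≤ n → ∀ (G : Graph) → IsArray n G →
    ∃[ H ] (H ∈ ℋ × Contains G H)) →
    Tasselled ℋ
theorem1p6 ℋ (N , arrays-contain) = N + maxSize ℋ , tassel
  where
  tassel : ∀ t → N + maxSize ℋ ≤ t → (s : Strand (N + maxSize ℋ)) →
    ∃[ H ] (H ∈ ℋ × ContainsComponentsIn H (tasselAdj t s))
  tassel t c≤t s with arrays-contain t (≤-trans (m≤m+n N _) c≤t) (Array.arrayGraph t s) (Array.arrayGraph-isArray t s)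
  ... | H , H∈ℋ , H⊆array =
    H , H∈ℋ , Array.tassel-containsComponents t s H (Array.arrayGraph-containsIn t s {H} H⊆array)
                (≤-trans (size≤maxSize H∈ℋ) (m≤n+m (maxSize ℋ) N))
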